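{- Let $3\le m\le n$ and let $c$ be an exact $(m+n+1)$-coloring of $[m]\times[n]$ with no rainbow solution to $x_1+x_2=x_3$. For each $\delta\in[m]\times[n]$ with $c(\delta)\notin c(D_m)$, $$\big|c([m]\times[n])\setminus c(D_m)\big|\le m+n-\frac12-\frac{|\mathbb{D}_\delta|}{3}.$$
   Context: $[m]\times[n]=\{(i,j)\in\mathbb{Z}^2:1\le i\le m,1\le j\le n\}$ with componentwise addition and subtraction. An $r$-coloring is a map $c:[m]\times[n]\to\{1,\dots,r\}$, exact if surjective; a rainbow solution is a triple $\alpha,\beta,\gamma$ with $\alpha+\beta=\gamma$ and pairwise distinct colors. For $1\le k\le m+n-1$, $D_k=\{(i,j)\in[m]\times[n]:m-k=i-j\}$; $D_m$ is the main diagonal; $c(X)=\{c(x):x\in X\}$. For $\delta\in[m]\times[n]$, $\mathbb{D}_\delta$ is the set of diagonals $D_g\ne D_m$ such that for every $\gamma\in D_g$, either $\gamma+\delta\in[m]\times[n]$ or $\gamma-\delta\in[m]\times[n]$. -}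

module Defs where

open import Data.Nat as ℕ using (ℕ; suc)
open import Data.Integer as ℤ using (ℤ; +_)
open import Data.Fin using (Fin)
open import Data.Fin.Properties using (_≟_)
open import Data.Product using (_×_; _,_; proj₁; proj₂; ∃)
open import Data.Sum using (_⊎_)
open import Data.List using (List; map; concatMap; upTo; allFin; filter; length)
open import Data.List.Relation.Unary.All using (All; all?)
open import Data.List.Relation.Unary.Any using (any?)
open import Relation.Nullary using (¬_; Dec; ¬?; _×-dec_; _⊎-dec_)
open import Relation.Binary.PropositionalEquality using (_≡_; _≢_)
import Data.Integer.Properties as ℤP
import Data.Nat.Properties as ℕP

Point : Set
Point = ℤ × ℤ

_⊕_ : Point → Point → Point
(a , b) ⊕ (c , d) = (a ℤ.+ c , b ℤ.+ d)

_⊖_ : Point → Point → Point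
(a , b) ⊖ (c , d) = (a ℤ.- c , b ℤ.- d)

InGrid : ℕ → ℕ → Point → Set
InGrid m n (i , j) = (+ 1 ℤ.≤ i × i ℤ.≤ + m) × (+ 1 ℤ.≤ j × j ℤ.≤ + n)

inGrid? : ∀ m n (p : Point) → Dec (InGrid m n p)
inGrid? m n (i , j) =
  ((+ 1 ℤ.≤? i) ×-dec (i ℤ.≤? + m)) ×-dec ((+ 1 ℤ.≤? j) ×-dec (j ℤ.≤? + n))

-- An r-coloring of [m]×[n]; values outside the grid are irrelevant
-- (every notion below only inspects points of the grid).
Coloring : ℕ → Set
Coloring r = Point → Fin r

Exact : ∀ m n {r} → Coloring r → Set
Exact m n {r} c = (k : Fin r) → ∃ λ p → InGrid m n p × c p ≡ k

RainbowSolution : ∀ m n {r} → Coloring r → Point → Point → Point → Set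
RainbowSolution m n c α β γ =
  InGrid m n α × InGrid m n β × InGrid m n γ × (α ⊕ β ≡ γ) ×
  (c α ≢ c β) × (c α ≢ c γ) × (c β ≢ c γ)

NoRainbow : ∀ m n {r} → Coloring r → Set
NoRainbow m n c = ∀ α β γ → ¬ RainbowSolution m n c α β γ

InDiag : ℕ → ℕ → ℕ → Point → Set
InDiag m n k (i , j) = InGrid m n (i , j) × ((+ m) ℤ.- (+ k) ≡ i ℤ.- j)

gridList : ℕ → ℕ → List Point
gridList m n =
  concatMap (λ i → map (λ j → (+ suc i , + suc j)) (upTo n)) (upTo m)

InDiagColours : ∀ m n {r} → Coloring r → Fin r → Set
InDiagColours m n c x = ∃ λ p → InDiag m n m p × c p ≡ x

inDiagColours? : ∀ m n {r} (c : Coloring r) (x : Fin r) →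
  Dec (All (λ p → ¬ (InDiag m n m p × c p ≡ x)) (gridList m n))
inDiagColours? m n c x = all? (λ p → ¬? (dec p)) (gridList m n)
  where
  dec : ∀ p → Dec (InDiag m n m p × c p ≡ x)
  dec (i , j) = (inGrid? m n (i , j) ×-dec ((+ m) ℤ.- (+ m) ℤ.≟ i ℤ.- j)) ×-dec (c (i , j) ≟ x)

nonDiagColourCount : ∀ m n {r} → Coloring r → ℕ
nonDiagColourCount m n {r} c =
  length (filter (λ x → attained x ×-dec inDiagColours? m n c x) (allFin r))
  where
  attained : (x : Fin r) → Dec (Data.List.Relation.Unary.Any.Any (λ p → InGrid m n p × c p ≡ x) (gridList m n))
  attained x = any? (λ p → inGrid? m n p ×-dec (c p ≟ x)) (gridList m n)

-- property of a diagonal D_g to belong to 𝔻_δ (apart from D_g ≠ D_m):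
-- for every γ ∈ D_g, γ + δ ∈ [m]×[n] or γ − δ ∈ [m]×[n]
GoodDiag : ℕ → ℕ → Point → ℕ → Set
GoodDiag m n δ g = ∀ γ → InDiag m n g γ → InGrid m n (γ ⊕ δ) ⊎ InGrid m n (γ ⊖ δ)

goodDiag? : ∀ m n δ g →
  Dec (All (λ γ → ¬ InDiag m n g γ ⊎ (InGrid m n (γ ⊕ δ) ⊎ InGrid m n (γ ⊖ δ))) (gridList m n))
goodDiag? m n δ g = all? (λ γ → ¬? (dg γ) ⊎-dec (inGrid? m n (γ ⊕ δ) ⊎-dec inGrid? m n (γ ⊖ δ))) (gridList m n)
  where
  dg : ∀ γ → Dec (InDiag m n g γ)
  dg (i , j) = inGrid? m n (i , j) ×-dec ((+ m) ℤ.- (+ g) ℤ.≟ i ℤ.- j)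

bigDCount : ℕ → ℕ → Point → ℕ
bigDCount m n δ =
  length (filter (λ g → ¬? (g ℕ.≟ m) ×-dec goodDiag? m n δ g)
                 (map suc (upTo (m ℕ.+ n ℕ.∸ 1))))

{-# OPTIONS --safe #-}
-- Two grid points on one diagonal whose colours avoid c(D_m) differ by a vector (t , t) of D_m,
-- so without rainbow solutions they have the same colour: each diagonal carries at most one
-- colour outside c(D_m). Mapping these colours, the set F of the remaining diagonals other than
-- D_m, and D_m itself injectively into the m + n − 1 diagonals gives
-- |c([m]×[n]) ∖ c(D_m)| + |F| + 1 ≤ m + n − 1.
-- A diagonal D_g of 𝔻_δ either lies in F, carries c(δ), or carries some x ≠ c(δ) at a point γ;
-- then γ + δ or γ − δ is a grid point, coloured x or c(δ) and off D_g, hence on a diagonal of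
-- F or the one carrying c(δ). So g is such a diagonal shifted by 0 or ±(δ₁ − δ₂), and
-- |𝔻_δ| ≤ 3 (|F| + 1).
module Submission where

open import Defs
open import Data.Nat using (ℕ; _≤_; _+_; _*_)
open import Data.Product using (_×_; ∃; _,_; proj₁; proj₂)
open import Relation.Nullary using (¬_; Dec; yes; no; ¬?; _×-dec_)

open import Data.Nat as ℕ using (suc; _<_; _∸_; z≤n; s≤s)
import Data.Nat.Properties as ℕP
open import Data.Nat.Tactic.RingSolver as ℕSolver using ()
open import Data.Integer as ℤ using (ℤ; +_; -[1+_]; _-_)
import Data.Integer.Properties as ℤP
open import Data.Integer.Tactic.RingSolver using (solve; solve-∀)
open import Data.Fin using (Fin)
open import Data.Fin.Properties using (_≟_)
open import Data.Sum using (_⊎_; inj₁; inj₂; [_,_]′)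
open import Data.Sum.Properties using (inj₁-injective; inj₂-injective)
import Data.Sum.Relation.Unary.All as Sum
open import Data.Empty using (⊥-elim)
open import Data.List using (List; []; _∷_; map; filter; length; upTo; allFin; _++_; cartesianProduct)
open import Data.List.Properties using (length-map; length-++; length-upTo)
open import Data.List.Relation.Unary.Any using (Any; any?; here; there)
open import Data.List.Relation.Unary.All as All using (All)
open import Data.List.Relation.Unary.AllPairs using (_∷_)
open import Data.List.Relation.Unary.Unique.Propositional using (Unique)
import Data.List.Relation.Unary.Unique.Propositional.Properties as Unique
open import Data.List.Membership.Propositional using (_∈_; _∉_; lose)
open import Data.List.Membership.Propositional.Properties
  using (∈-map⁺; ∈-map⁻; ∈-++⁻; ∈-filter⁺; ∈-filter⁻; ∈-upTo⁺; ∈-concatMap⁺; ∈-cartesianProduct⁺)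
open import Data.List.Membership.DecPropositional ℤ._≟_ using (_∈?_)
open import Relation.Binary.PropositionalEquality
open import Relation.Binary.Definitions using (tri<; tri≈; tri>)

-- Counting by injections

∈-remove : ∀ {B : Set} {y : B} {ys : List B} → y ∈ ys →
  ∃ λ ys′ → length ys ≡ suc (length ys′) × (∀ {z} → z ∈ ys → z ≢ y → z ∈ ys′)
∈-remove {ys = _ ∷ ys} (here refl) =
  ys , refl , λ { (here refl) z≢y → ⊥-elim (z≢y refl) ; (there z∈) _ → z∈ }
∈-remove {ys = w ∷ _} (there y∈) with ys′ , len , keep ← ∈-remove y∈ =
  w ∷ ys′ , cong suc len , λ { (here refl) _ → here refl ; (there z∈) z≢y → there (keep z∈ z≢y) }

injection⇒length≤ : ∀ {A B : Set} (R : A → B → Set) {xs : List A} {ys : List B} →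
  Unique xs →
  (∀ {x} → x ∈ xs → ∃ λ y → y ∈ ys × R x y) →
  (∀ {x x′ y} → x ∈ xs → x′ ∈ xs → R x y → R x′ y → x ≡ x′) →
  length xs ≤ length ys
injection⇒length≤ R {[]} _ _ _ = z≤n
injection⇒length≤ R {x ∷ xs} {ys} (x∉xs ∷ unique) image injective
  with y , y∈ys , Rxy ← image (here refl)
  with ys′ , len , keep ← ∈-remove y∈ys =
  subst (suc (length xs) ≤_) (sym len)
    (s≤s (injection⇒length≤ R unique image′ (λ p q → injective (there p) (there q))))
  where
  image′ : ∀ {x′} → x′ ∈ xs → ∃ λ y′ → y′ ∈ ys′ × R x′ y′
  image′ x′∈ with y′ , y′∈ys , Rx′y′ ← image (there x′∈) = y′ , keep y′∈ys y′≢y , Rx′y′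
    where
    y′≢y : y′ ≢ y
    y′≢y refl = All.lookup x∉xs x′∈ (injective (here refl) (there x′∈) Rxy Rx′y′)

∈-++-inj⁻ : ∀ {A B : Set} {xs : List A} {ys : List B} {v} →
  v ∈ map inj₁ xs ++ map inj₂ ys → Sum.All (_∈ xs) (_∈ ys) v
∈-++-inj⁻ {xs = xs} v∈ with ∈-++⁻ (map inj₁ xs) v∈
... | inj₁ p with _ , x∈ , refl ← ∈-map⁻ inj₁ p = Sum.inj₁ x∈
... | inj₂ p with _ , y∈ , refl ← ∈-map⁻ inj₂ p = Sum.inj₂ y∈

unique-++-inj : ∀ {A B : Set} {xs : List A} {ys : List B} →
  Unique xs → Unique ys → Unique (map inj₁ xs ++ map inj₂ ys)
unique-++-inj {xs = xs} uxs uys =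
  Unique.++⁺ (Unique.map⁺ inj₁-injective uxs) (Unique.map⁺ inj₂-injective uys) disjoint
  where
  disjoint : ∀ {v} → ¬ (v ∈ map inj₁ xs × v ∈ map inj₂ _)
  disjoint (p , q) with _ , _ , refl ← ∈-map⁻ inj₁ p with _ , _ , () ← ∈-map⁻ inj₂ q

length-++-inj : ∀ {A B : Set} (xs : List A) (ys : List B) →
  length (map inj₁ xs ++ map inj₂ ys) ≡ length xs + length ys
length-++-inj xs ys =
  trans (length-++ (map inj₁ xs)) (cong₂ _+_ (length-map inj₁ xs) (length-map inj₂ ys))

length-cartesianProduct : ∀ {A B : Set} (xs : List A) (ys : List B) →
  length (cartesianProduct xs ys) ≡ length xs * length ys
length-cartesianProduct [] ys = refl
length-cartesianProduct (x ∷ xs) ys = begin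
  length (map (x ,_) ys ++ cartesianProduct xs ys)          ≡⟨ length-++ (map (x ,_) ys) ⟩
  length (map (x ,_) ys) + length (cartesianProduct xs ys)  ≡⟨ cong₂ _+_ (length-map (x ,_) ys)
                                                                        (length-cartesianProduct xs ys) ⟩
  length ys + length xs * length ys                         ∎
  where open ≡-Reasoning

-- Diagonals of the grid

i-[i-j]≡j : ∀ i j → i - (i - j) ≡ j
i-[i-j]≡j = solve-∀

i+j≡i⇒j≡0 : ∀ i j → i ℤ.+ j ≡ i → j ≡ + 0
i+j≡i⇒j≡0 i j e = begin
  j                ≡⟨ solve (i ∷ j ∷ []) ⟩
  (i ℤ.+ j) - i    ≡⟨ cong (_- i) e ⟩
  i - i            ≡⟨ ℤP.+-inverseʳ i ⟩
  + 0              ∎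
  where open ≡-Reasoning

offset : Point → ℤ
offset (i , j) = i - j

diagIndex : ℕ → Point → ℤ
diagIndex m p = + m - offset p

diagonalIndices : ℕ → ℕ → List ℕ
diagonalIndices m n = map suc (upTo (m + n ∸ 1))

∈-diagonalIndices : ∀ {m n k} → 1 ≤ k → k ≤ m + n ∸ 1 → k ∈ diagonalIndices m n
∈-diagonalIndices {k = suc k} _ k<K = ∈-map⁺ suc (∈-upTo⁺ k<K)

diagonalIndices-unique : ∀ m n → Unique (diagonalIndices m n)
diagonalIndices-unique m n = Unique.map⁺ ℕP.suc-injective (Unique.upTo⁺ (m + n ∸ 1))

∈-gridList : ∀ {m n p} → InGrid m n p → p ∈ gridList m n
∈-gridList {m} {n} {+ suc i , + suc j} ((_ , ℤ.+≤+ i≤m) , (_ , ℤ.+≤+ j≤n)) =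
  ∈-concatMap⁺ (λ i → map (λ j → (+ suc i , + suc j)) (upTo n))
    (lose (∈-upTo⁺ i≤m) (∈-map⁺ (λ j → (+ suc i , + suc j)) (∈-upTo⁺ j≤n)))
∈-gridList {p = + 0 , _} ((ℤ.+≤+ () , _) , _)
∈-gridList {p = + suc _ , + 0} (_ , (ℤ.+≤+ () , _))

diagIndex⇒inDiag : ∀ {m n g p} → InGrid m n p → + g ≡ diagIndex m p → InDiag m n g p
diagIndex⇒inDiag {m} {p = p} p∈ e = p∈ , trans (cong ((+ m) -_) e) (i-[i-j]≡j (+ m) (offset p))

diagIndex-injective : ∀ m {p q} → diagIndex m p ≡ diagIndex m q → offset p ≡ offset q
diagIndex-injective m {p} {q} e =
  trans (sym (i-[i-j]≡j (+ m) (offset p))) (trans (cong ((+ m) -_) e) (i-[i-j]≡j (+ m) (offset q)))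

diagIndex-⊕ : ∀ m p q → diagIndex m (p ⊕ q) ℤ.+ offset q ≡ diagIndex m p
diagIndex-⊕ m (i , j) (a , b) = identity (+ m) i j a b
  where
  identity : ∀ M i j a b → (M - ((i ℤ.+ a) - (j ℤ.+ b))) ℤ.+ (a - b) ≡ M - (i - j)
  identity = solve-∀

diagIndex-⊖ : ∀ m p q → diagIndex m (p ⊖ q) - offset q ≡ diagIndex m p
diagIndex-⊖ m (i , j) (a , b) = identity (+ m) i j a b
  where
  identity : ∀ M i j a b → (M - ((i - a) - (j - b))) - (a - b) ≡ M - (i - j)
  identity = solve-∀

⊖-⊕-cancel : ∀ p q → (p ⊖ q) ⊕ q ≡ p
⊖-⊕-cancel (i , j) (a , b) = cong₂ _,_ (identity i a) (identity j b)
  where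
  identity : ∀ i a → (i - a) ℤ.+ a ≡ i
  identity = solve-∀

diagIndex-bounds : ∀ {m n p} → InGrid m n p →
  ∃ λ k → diagIndex m p ≡ + k × k ∈ diagonalIndices m n
diagIndex-bounds {m} {n} {i , j} ((1≤i , i≤m) , (1≤j , j≤n)) =
  ℤ.∣ d ∣ , sym +∣d∣≡d ,
  ∈-diagonalIndices {m} {n} (ℤP.drop‿+≤+ (subst (+ 1 ℤ.≤_) (sym +∣d∣≡d) lower))
                    (ℤP.drop‿+≤+ (subst (ℤ._≤ + (m + n ∸ 1)) (sym +∣d∣≡d) upper))
  where
  d = diagIndex m (i , j)
  d≡ : d ≡ (+ m - i) ℤ.+ j
  d≡ = identity (+ m) i j
    where
    identity : ∀ M i j → M - (i - j) ≡ (M - i) ℤ.+ j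
    identity = solve-∀
  corner : ∀ m → 1 ≤ m → (+ m - + 1) ℤ.+ + n ≡ + (m + n ∸ 1)
  corner (suc m) _ = refl
  lower : + 1 ℤ.≤ d
  lower = subst (+ 1 ℤ.≤_) (sym d≡) (ℤP.+-mono-≤ (ℤP.i≤j⇒0≤j-i i≤m) 1≤j)
  upper : d ℤ.≤ + (m + n ∸ 1)
  upper = subst₂ ℤ._≤_ (sym d≡) (corner m (ℤP.drop‿+≤+ (ℤP.≤-trans 1≤i i≤m)))
            (ℤP.+-mono-≤ (ℤP.+-monoʳ-≤ (+ m) (ℤP.neg-mono-≤ 1≤i)) j≤n)
  +∣d∣≡d : + ℤ.∣ d ∣ ≡ d
  +∣d∣≡d = ℤP.0≤i⇒+∣i∣≡i (ℤP.≤-trans (ℤ.+≤+ z≤n) lower)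

mainDiagonal-step : ∀ {m n a a′ j j′} → m ≤ n →
  InGrid m n (+ a , j) → InGrid m n (+ a′ , j′) → a′ < a → + a - j ≡ + a′ - j′ →
  ∃ λ τ → InDiag m n m τ × (+ a′ , j′) ⊕ τ ≡ (+ a , j)
mainDiagonal-step {m} {n} {a} {a′} {j} {j′} m≤n ((_ , a≤m) , _) _ a′<a e =
  (+ t , + t) , (τ∈grid , onMain) , cong₂ _,_ (cong +_ (ℕP.m+[n∸m]≡n (ℕP.<⇒≤ a′<a))) second
  where
  open ≡-Reasoning
  t = a ∸ a′
  t≤m : t ≤ m
  t≤m = ℕP.≤-trans (ℕP.m∸n≤m a a′) (ℤP.drop‿+≤+ a≤m)
  τ∈grid : InGrid m n (+ t , + t)
  τ∈grid = (ℤ.+≤+ (ℕP.m<n⇒0<n∸m a′<a) , ℤ.+≤+ t≤m)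
         , (ℤ.+≤+ (ℕP.m<n⇒0<n∸m a′<a) , ℤ.+≤+ (ℕP.≤-trans t≤m m≤n))
  onMain : + m - + m ≡ + t - + t
  onMain = trans (ℤP.+-inverseʳ (+ m)) (sym (ℤP.+-inverseʳ (+ t)))
  t≡a-a′ : + t ≡ + a - + a′
  t≡a-a′ = sym (trans (ℤP.[+m]-[+n]≡m⊖n a a′) (ℤP.≤-⊖ (ℕP.<⇒≤ a′<a)))
  identity : ∀ j′ A A′ → j′ ℤ.+ (A - A′) ≡ A - (A′ - j′)
  identity = solve-∀
  second : j′ ℤ.+ + t ≡ j
  second = begin
    j′ ℤ.+ + t              ≡⟨ cong (ℤ._+_ j′) t≡a-a′ ⟩
    j′ ℤ.+ (+ a - + a′)     ≡⟨ identity j′ (+ a) (+ a′) ⟩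
    + a - (+ a′ - j′)       ≡⟨ cong ((+ a) -_) (sym e) ⟩
    + a - (+ a - j)         ≡⟨ i-[i-j]≡j (+ a) j ⟩
    j                       ∎

-- Colourings without rainbow solutions

OffDiagonal : ∀ m n {r} → Coloring r → Fin r → Set
OffDiagonal m n c x = ¬ InDiagColours m n c x

module _ {m n r : ℕ} {c : Coloring r} where

  noRainbow⇒repeatedColour : NoRainbow m n c → ∀ {α β γ} →
    InGrid m n α → InGrid m n β → InGrid m n γ → α ⊕ β ≡ γ →
    c α ≡ c β ⊎ c α ≡ c γ ⊎ c β ≡ c γ
  noRainbow⇒repeatedColour noRainbow {α} {β} {γ} α∈ β∈ γ∈ sum
    with c α ≟ c β | c α ≟ c γ | c β ≟ c γ
  ... | yes e | _     | _     = inj₁ e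
  ... | no _  | yes e | _     = inj₂ (inj₁ e)
  ... | no _  | no _  | yes e = inj₂ (inj₂ e)
  ... | no ≢₁ | no ≢₂ | no ≢₃ = ⊥-elim (noRainbow α β γ (α∈ , β∈ , γ∈ , sum , ≢₁ , ≢₂ , ≢₃))

  offDiagonal⇒diagIndex≢m : ∀ {p} → InGrid m n p → OffDiagonal m n c (c p) → diagIndex m p ≢ + m
  offDiagonal⇒diagIndex≢m {p} p∈ off e = off (p , diagIndex⇒inDiag p∈ (sym e) , refl)

  -- (+ a , j) is (+ a′ , j′) translated by a point of D_m, whose colour both avoid.
  sameOffset⇒sameColour-ordered : m ≤ n → NoRainbow m n c → ∀ {a a′ j j′} →
    InGrid m n (+ a , j) → InGrid m n (+ a′ , j′) → a′ < a → + a - j ≡ + a′ - j′ →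
    OffDiagonal m n c (c (+ a , j)) → OffDiagonal m n c (c (+ a′ , j′)) →
    c (+ a , j) ≡ c (+ a′ , j′)
  sameOffset⇒sameColour-ordered m≤n noRainbow α∈ β∈ a′<a e offα offβ
    with τ , τ∈D , sum ← mainDiagonal-step m≤n α∈ β∈ a′<a e
    with noRainbow⇒repeatedColour noRainbow β∈ (proj₁ τ∈D) α∈ sum
  ... | inj₁ cβ≡cτ        = ⊥-elim (offβ (τ , τ∈D , sym cβ≡cτ))
  ... | inj₂ (inj₁ cβ≡cα) = sym cβ≡cα
  ... | inj₂ (inj₂ cτ≡cα) = ⊥-elim (offα (τ , τ∈D , cτ≡cα))

  sameOffset⇒sameColour : m ≤ n → NoRainbow m n c → ∀ {α β} →
    InGrid m n α → InGrid m n β → offset α ≡ offset β →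
    OffDiagonal m n c (c α) → OffDiagonal m n c (c β) → c α ≡ c β
  sameOffset⇒sameColour m≤n noRainbow {+ a , j} {+ a′ , j′} α∈ β∈ e offα offβ
    with ℕP.<-cmp a′ a
  ... | tri< a′<a _ _ = sameOffset⇒sameColour-ordered m≤n noRainbow α∈ β∈ a′<a e offα offβ
  ... | tri> _ _ a<a′ = sym (sameOffset⇒sameColour-ordered m≤n noRainbow β∈ α∈ a<a′ (sym e) offβ offα)
  ... | tri≈ _ refl _ =
    cong (λ j → c (+ a , j)) (trans (sym (i-[i-j]≡j (+ a) j)) (trans (cong ((+ a) -_) e) (i-[i-j]≡j (+ a) j′)))
  sameOffset⇒sameColour _ _ { -[1+ _ ] , _} ((() , _) , _)
  sameOffset⇒sameColour _ _ {+ _ , _} { -[1+ _ ] , _} _ ((() , _) , _)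

-- Counting off-diagonal colours and good diagonals

module OffDiagonalCount (m n : ℕ) (1≤m : 1 ≤ m) (m≤n : m ≤ n)
  (c : Coloring (m + n + 1)) (exact : Exact m n c) (noRainbow : NoRainbow m n c) where

  Colour : Set
  Colour = Fin (m + n + 1)

  Off : Colour → Set
  Off = OffDiagonal m n c

  witness : Colour → Point
  witness x = proj₁ (exact x)

  witness∈grid : ∀ x → InGrid m n (witness x)
  witness∈grid x = proj₁ (proj₂ (exact x))

  c-witness : ∀ x → c (witness x) ≡ x
  c-witness x = proj₂ (proj₂ (exact x))

  -- offColour? and goodDiagonal? below are the predicates filtered by nonDiagColourCount and
  -- bigDCount, so that the counts agree by definition.
  offColour? : (x : Colour) →
    Dec (Any (λ p → InGrid m n p × c p ≡ x) (gridList m n)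
         × All (λ p → ¬ (InDiag m n m p × c p ≡ x)) (gridList m n))
  offColour? x =
    any? (λ p → inGrid? m n p ×-dec (c p ≟ x)) (gridList m n) ×-dec inDiagColours? m n c x

  offColours : List Colour
  offColours = filter offColour? (allFin _)

  ∈offColours⇒off : ∀ {x} → x ∈ offColours → Off x
  ∈offColours⇒off x∈ (p , p∈D , cp≡x) =
    All.lookup (proj₂ (proj₂ (∈-filter⁻ offColour? {xs = allFin _} x∈)))
      (∈-gridList (proj₁ p∈D)) (p∈D , cp≡x)

  witness-off : ∀ {x} → x ∈ offColours → Off (c (witness x))
  witness-off {x} x∈ = subst Off (sym (c-witness x)) (∈offColours⇒off x∈)

  diagOf : Colour → ℤ
  diagOf x = diagIndex m (witness x)

  colourOnDiagonal : ∀ {p x} → InGrid m n p → Off (c p) → x ∈ offColours →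
    diagIndex m p ≡ diagOf x → c p ≡ x
  colourOnDiagonal {p} {x} p∈ off x∈ e =
    trans (sameOffset⇒sameColour m≤n noRainbow p∈ (witness∈grid x)
             (diagIndex-injective m {p} {witness x} e) off (witness-off x∈))
          (c-witness x)

  diagOf-injective : ∀ {x x′} → x ∈ offColours → x′ ∈ offColours → diagOf x ≡ diagOf x′ → x ≡ x′
  diagOf-injective {x} x∈ x′∈ e =
    trans (sym (c-witness x)) (colourOnDiagonal (witness∈grid x) (witness-off x∈) x′∈ e)

  occupied : List ℤ
  occupied = map diagOf offColours

  indices : List ℕ
  indices = diagonalIndices m n

  Free? : (g : ℕ) → Dec (¬ g ≡ m × + g ∉ occupied)
  Free? g = ¬? (g ℕ.≟ m) ×-dec ¬? (+ g ∈? occupied)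

  free : List ℕ
  free = filter Free? indices

  m∈indices : m ∈ indices
  m∈indices = ∈-diagonalIndices {m} {n} 1≤m
    (ℕP.≤-trans (ℕP.m≤m+n m (n ∸ 1)) (ℕP.≤-reflexive (sym (ℕP.+-∸-assoc m 1≤n))))
    where
    1≤n : 1 ≤ n
    1≤n = ℕP.≤-trans 1≤m m≤n

  diagOf≢unoccupied : ∀ {x g} → x ∈ offColours → g ∈ m ∷ free → diagOf x ≢ + g
  diagOf≢unoccupied {x} x∈ (here refl) = offDiagonal⇒diagIndex≢m (witness∈grid x) (witness-off x∈)
  diagOf≢unoccupied {x} x∈ (there g∈) e =
    proj₂ (proj₂ (∈-filter⁻ Free? {xs = indices} g∈)) (subst (_∈ occupied) e (∈-map⁺ diagOf x∈))

  -- Off-diagonal colours, unoccupied diagonals and D_m are sent to distinct diagonals.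
  offColours+unoccupied≤diagonals : length offColours + suc (length free) ≤ m + n ∸ 1
  offColours+unoccupied≤diagonals =
    subst₂ _≤_ (length-++-inj offColours (m ∷ free))
               (trans (length-map suc (upTo (m + n ∸ 1))) (length-upTo (m + n ∸ 1)))
      (injection⇒length≤ Hits (unique-++-inj (Unique.filter⁺ offColour? (Unique.allFin⁺ _)) m∷free-unique)
        (λ v∈ → image (∈-++-inj⁻ v∈)) (λ v∈ v′∈ → injective (∈-++-inj⁻ v∈) (∈-++-inj⁻ v′∈)))
    where
    Hits : Colour ⊎ ℕ → ℕ → Set
    Hits v k = [ diagOf , +_ ]′ v ≡ + k

    m∷free-unique : Unique (m ∷ free)
    m∷free-unique = All.tabulate (λ {g} g∈ m≡g → proj₁ (proj₂ (∈-filter⁻ Free? {xs = indices} g∈)) (sym m≡g))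
           ∷ Unique.filter⁺ Free? (diagonalIndices-unique m n)

    image : ∀ {v} → Sum.All (_∈ offColours) (_∈ m ∷ free) v → ∃ λ k → k ∈ indices × Hits v k
    image (Sum.inj₁ {x} _) with k , e , k∈ ← diagIndex-bounds (witness∈grid x) = k , k∈ , e
    image (Sum.inj₂ (here refl)) = m , m∈indices , refl
    image (Sum.inj₂ {g} (there g∈)) = g , proj₁ (∈-filter⁻ Free? {xs = indices} g∈) , refl

    injective : ∀ {v v′ k} →
      Sum.All (_∈ offColours) (_∈ m ∷ free) v → Sum.All (_∈ offColours) (_∈ m ∷ free) v′ →
      Hits v k → Hits v′ k → v ≡ v′
    injective (Sum.inj₁ x∈) (Sum.inj₁ x′∈) e e′ = cong inj₁ (diagOf-injective x∈ x′∈ (trans e (sym e′)))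
    injective (Sum.inj₁ x∈) (Sum.inj₂ g∈) e e′ = ⊥-elim (diagOf≢unoccupied x∈ g∈ (trans e (sym e′)))
    injective (Sum.inj₂ g∈) (Sum.inj₁ x∈) e e′ = ⊥-elim (diagOf≢unoccupied x∈ g∈ (trans e′ (sym e)))
    injective (Sum.inj₂ _) (Sum.inj₂ _) e e′ = cong inj₂ (ℤP.+-injective (trans e (sym e′)))

  module _ (δ : Point) (δ∈grid : InGrid m n δ) (δ-off : Off (c δ)) where

    targets : List ℤ
    targets = diagOf (c δ) ∷ map +_ free

    colour⇒off : ∀ {p x} → x ∈ offColours → c p ≡ x ⊎ c p ≡ c δ → Off (c p)
    colour⇒off x∈ (inj₁ cp≡x) = subst Off (sym cp≡x) (∈offColours⇒off x∈)
    colour⇒off _ (inj₂ cp≡cδ) = subst Off (sym cp≡cδ) δ-off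

    diagIndex∈targets : ∀ {p x} → InGrid m n p → x ∈ offColours → c p ≡ x ⊎ c p ≡ c δ →
      diagIndex m p ≢ diagOf x → diagIndex m p ∈ targets
    diagIndex∈targets {p} {x} p∈ x∈ colour p≢x with k , e , k∈ ← diagIndex-bounds p∈ with + k ∈? occupied
    ... | no k∉ = there (subst (_∈ map +_ free) (sym e) (∈-map⁺ +_ (∈-filter⁺ Free? k∈ (k≢m , k∉))))
      where
      k≢m : ¬ k ≡ m
      k≢m refl = offDiagonal⇒diagIndex≢m p∈ (colour⇒off x∈ colour) e
    ... | yes k∈occ with x′ , x′∈ , k≡x′ ← ∈-map⁻ diagOf k∈occ
      with colourOnDiagonal p∈ (colour⇒off x∈ colour) x′∈ (trans e k≡x′) | colour
    ...   | cp≡x′ | inj₁ cp≡x  = ⊥-elim (p≢x (trans e (trans k≡x′ (cong diagOf (trans (sym cp≡x′) cp≡x)))))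
    ...   | cp≡x′ | inj₂ cp≡cδ = here (trans e (trans k≡x′ (cong diagOf (trans (sym cp≡x′) cp≡cδ))))

    colourAbove : ∀ {x} → x ≢ c δ → InGrid m n (witness x ⊕ δ) →
      c (witness x ⊕ δ) ≡ x ⊎ c (witness x ⊕ δ) ≡ c δ
    colourAbove {x} x≢cδ p∈ with noRainbow⇒repeatedColour noRainbow (witness∈grid x) δ∈grid p∈ refl
    ... | inj₁ cγ≡cδ        = ⊥-elim (x≢cδ (trans (sym (c-witness x)) cγ≡cδ))
    ... | inj₂ (inj₁ cγ≡cp) = inj₁ (trans (sym cγ≡cp) (c-witness x))
    ... | inj₂ (inj₂ cδ≡cp) = inj₂ (sym cδ≡cp)

    colourBelow : ∀ {x} → x ≢ c δ → InGrid m n (witness x ⊖ δ) →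
      c (witness x ⊖ δ) ≡ x ⊎ c (witness x ⊖ δ) ≡ c δ
    colourBelow {x} x≢cδ p∈
      with noRainbow⇒repeatedColour noRainbow p∈ δ∈grid (witness∈grid x) (⊖-⊕-cancel (witness x) δ)
    ... | inj₁ cp≡cδ        = inj₂ cp≡cδ
    ... | inj₂ (inj₁ cp≡cγ) = inj₁ (trans cp≡cγ (c-witness x))
    ... | inj₂ (inj₂ cδ≡cγ) = ⊥-elim (x≢cδ (trans (sym (c-witness x)) (sym cδ≡cγ)))

    offset-δ≢0 : offset δ ≢ + 0
    offset-δ≢0 e =
      offDiagonal⇒diagIndex≢m δ∈grid δ-off (trans (cong (_-_ (+ m)) e) (ℤP.+-identityʳ (+ m)))

    shifts : List ℤ
    shifts = + 0 ∷ offset δ ∷ ℤ.- offset δ ∷ []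

    shiftedTargets : List (ℤ × ℤ)
    shiftedTargets = cartesianProduct shifts targets

    ∈-shiftedTargets : ∀ {s z} → s ∈ shifts → z ∈ targets → (s , z) ∈ shiftedTargets
    ∈-shiftedTargets = ∈-cartesianProduct⁺

    Shifted : ℕ → ℤ × ℤ → Set
    Shifted g (s , z) = z ℤ.+ s ≡ + g

    shiftedTarget : ∀ {p x g} → InGrid m n p → x ∈ offColours → c p ≡ x ⊎ c p ≡ c δ →
      ∀ {s} → s ∈ shifts → s ≢ + 0 → diagIndex m p ℤ.+ s ≡ + g → + g ≡ diagOf x →
      ∃ λ w → w ∈ shiftedTargets × Shifted g w
    shiftedTarget {p} p∈ x∈ colour {s} s∈ s≢0 e g≡x =
      (s , diagIndex m p) , ∈-shiftedTargets s∈ (diagIndex∈targets p∈ x∈ colour p≢x) , e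
      where
      p≢x : diagIndex m p ≢ diagOf _
      p≢x p≡x = s≢0 (i+j≡i⇒j≡0 (diagIndex m p) s (trans e (trans g≡x (sym p≡x))))

    goodDiagonal? : (g : ℕ) → Dec (¬ g ≡ m ×
      All (λ γ → ¬ InDiag m n g γ ⊎ (InGrid m n (γ ⊕ δ) ⊎ InGrid m n (γ ⊖ δ))) (gridList m n))
    goodDiagonal? g = ¬? (g ℕ.≟ m) ×-dec goodDiag? m n δ g

    goodDiagonals : List ℕ
    goodDiagonals = filter goodDiagonal? indices

    -- If g carries x ≠ c δ at γ, goodness puts γ + δ or γ − δ in the grid, on the
    -- target diagonal g − offset δ or g + offset δ respectively.
    goodDiagonal⇒shifted : ∀ {g} → g ∈ goodDiagonals →
      ∃ λ w → w ∈ shiftedTargets × Shifted g w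
    goodDiagonal⇒shifted {g} g∈ with g∈indices , g≢m , good ← ∈-filter⁻ goodDiagonal? {xs = indices} g∈
      with + g ∈? occupied
    ... | no g∉ = (+ 0 , + g)
                , ∈-shiftedTargets (here refl)
                    (there (∈-map⁺ +_ (∈-filter⁺ Free? g∈indices (g≢m , g∉))))
                , ℤP.+-identityʳ (+ g)
    ... | yes g∈occ with x , x∈ , g≡x ← ∈-map⁻ diagOf g∈occ with x ≟ c δ
    ...   | yes refl = (+ 0 , diagOf (c δ)) , ∈-shiftedTargets (here refl) (here refl)
                     , trans (ℤP.+-identityʳ _) (sym g≡x)
    ...   | no x≢cδ with All.lookup good (∈-gridList (witness∈grid x))
    ...     | inj₁ notOnDiagonal = ⊥-elim (notOnDiagonal (diagIndex⇒inDiag (witness∈grid x) g≡x))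
    ...     | inj₂ (inj₁ above∈) =
      shiftedTarget above∈ x∈ (colourAbove x≢cδ above∈) (there (here refl)) offset-δ≢0
        (trans (diagIndex-⊕ m (witness x) δ) (sym g≡x)) g≡x
    ...     | inj₂ (inj₂ below∈) =
      shiftedTarget below∈ x∈ (colourBelow x≢cδ below∈) (there (there (here refl)))
        (λ e → offset-δ≢0 (ℤP.neg-injective e)) (trans (diagIndex-⊖ m (witness x) δ) (sym g≡x)) g≡x

    goodDiagonals≤ : length goodDiagonals ≤ 3 * suc (length free)
    goodDiagonals≤ = subst (length goodDiagonals ≤_) len
      (injection⇒length≤ Shifted (Unique.filter⁺ goodDiagonal? (diagonalIndices-unique m n))
        goodDiagonal⇒shifted (λ {_} {_} {w} _ _ → shifted-injective w))
      where
      shifted-injective : ∀ w {g g′} → Shifted g w → Shifted g′ w → g ≡ g′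
      shifted-injective (s , z) e e′ = ℤP.+-injective (trans (sym e) e′)
      len : length shiftedTargets ≡ 3 * suc (length free)
      len = trans (length-cartesianProduct shifts targets) (cong (λ l → 3 * suc l) (length-map +_ free))

arithmetic : ∀ {a b t k} → a + suc t ≤ k → b ≤ 3 * suc t → 6 * a + 2 * b + 3 ≤ 6 * suc k
arithmetic {a} {b} {t} {k} a+t<k b≤ = begin
  6 * a + 2 * b + 3            ≤⟨ ℕP.+-monoˡ-≤ 3 (ℕP.+-monoʳ-≤ (6 * a) (ℕP.*-monoʳ-≤ 2 b≤)) ⟩
  6 * a + 2 * (3 * suc t) + 3  ≡⟨ ℕSolver.solve (a ∷ t ∷ []) ⟩
  6 * (a + suc t) + 3          ≤⟨ ℕP.+-monoˡ-≤ 3 (ℕP.*-monoʳ-≤ 6 a+t<k) ⟩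
  6 * k + 3                    ≤⟨ ℕP.+-monoʳ-≤ (6 * k) (ℕP.m≤m+n 3 3) ⟩
  6 * k + 6                    ≡⟨ ℕP.+-comm (6 * k) 6 ⟩
  6 + 6 * k                    ≡⟨ ℕP.*-suc 6 k ⟨
  6 * suc k                    ∎
  where open ℕP.≤-Reasoning

lemma4p1 : (m n : ℕ) → 3 ≤ m → m ≤ n →
    (c : Coloring (m + n + 1)) → Exact m n c → NoRainbow m n c →
    (δ : Point) → InGrid m n δ → ¬ InDiagColours m n c (c δ) →
    6 * nonDiagColourCount m n c + 2 * bigDCount m n δ + 3 ≤ 6 * (m + n)
lemma4p1 m n 3≤m m≤n c exact noRainbow δ δ∈grid δ-off =
  subst (λ k → 6 * length offColours + 2 * length (goodDiagonals δ δ∈grid δ-off) + 3 ≤ 6 * k)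
    (ℕP.m+[n∸m]≡n (ℕP.≤-trans 1≤m (ℕP.m≤m+n m n)))
    (arithmetic offColours+unoccupied≤diagonals (goodDiagonals≤ δ δ∈grid δ-off))
  where
  1≤m : 1 ≤ m
  1≤m = ℕP.≤-trans (s≤s z≤n) 3≤m
  open OffDiagonalCount m n 1≤m m≤n c exact noRainbow
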